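{- For every integer $r\geq2$, a reduced hypergraph $\mathcal A$ contains an $[r,2]$-fortress if and only if it contains a clique of order $2^r$.
   Context: Reduced hypergraph: a finite index set $I$; for distinct $i,j\in I$ a finite nonempty vertex class $\mathcal P^{ij}=\mathcal P^{ji}$, pairwise disjoint for distinct unordered pairs; for distinct $i,j,k\in I$ a tripartite $3$-uniform hypergraph $\mathcal A^{ijk}$ with classes $\mathcal P^{ij},\mathcal P^{ik},\mathcal P^{jk}$; $E(\mathcal A)$ is the union of the $E(\mathcal A^{ijk})$. A clique of order $t$ consists of $J\subseteq I$ with $|J|=t$ and $P^{ij}\in\mathcal P^{ij}$ for distinct $i,j\in J$ with $\{P^{ij},P^{ik},P^{jk}\}\in E(\mathcal A^{ijk})$ for all distinct $i,j,k\in J$. Sequences: for $a=(a_1,\dots,a_k)$, $|a|=k$, $a|\ell=(a_1,\dots,a_\ell)$ for $0\le\ell\le k$, $a(\ell)=a_\ell$, $a\wedge b$ is the longest common initial segment of $a$ and $b$; a direct continuation of $a$ is a sequence of length $k+1$ whose restriction to length $k$ is $a$. An $M$-ary tree of height $k$ is a set $T$ of sequences of length at most $k$ containing the empty sequence such that each $a\in T$ with $|a|<k$ has exactly $M$ direct continuations in $T$; $\mathscr S_T(a)=\{\sigma:(a_1,\dots,a_\ell,\sigma)\in T\}$ for $a=(a_1,\dots,a_\ell)$; $[T]$ is the set of elements of $T$ of length $k$; a $[k,M]$-system is a set of the form $[T]$. For $c=(c_1,\dots,c_\ell)\in T$, $Q(c)=\{(d_1,\dots,d_\ell): d_i\in\mathscr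 S_T(c|(i-1))\setminus\{c_i\}\text{ for all }i\in[\ell]\}$ (so $Q(\emptyset)=\{\emptyset\}$). Fortress: let $T$ be an $M$-ary tree of height $k$ and $\mathcal A$ a reduced hypergraph whose index set contains $S=[T]$. $S$ supports a fortress in $\mathcal A$ if for every two distinct $a,b\in S$ and every $d\in Q(a\wedge b)$ there is a vertex $P^{ab}_d\in\mathcal P^{ab}$ such that for all distinct $a,b,c\in S$ with $s:=|a\wedge b|=|a\wedge c|<|b\wedge c|$ and every $d\in Q(b\wedge c)$ with $d(s+1)=a(s+1)$ we have $\{P^{ab}_{d|s},P^{ac}_{d|s},P^{bc}_d\}\in E(\mathcal A^{abc})$. $\mathcal A$ contains a $[k,M]$-fortress if some subset of its index set is a $[k,M]$-system (i.e. equals $[T]$ for an $M$-ary tree $T$ of height $k$) supporting a fortress in $\mathcal A$. -}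

module Defs where

open import Data.Nat using (ℕ; zero; suc; _≤_; _<_; _≟_)
open import Data.Fin using (Fin)
open import Data.List using (List; []; _∷_; _∷ʳ_; length; take; drop)
open import Data.Maybe using (Maybe; just; nothing)
open import Data.Product using (Σ; ∃; _×_; _,_)
open import Data.Unit using (⊤)
open import Data.Empty using (⊥)
open import Relation.Nullary using (¬_; yes; no)
open import Relation.Binary.PropositionalEquality using (_≡_; _≢_)
open import Function.Bundles using (_⇔_)
open import Function.Definitions using (Injective)

-- The vertex class P^{ij} (= P^{ji}) is
-- {0, …, size i j - 1}, a vertex being tagged by its (unordered) class,
-- so classes of distinct pairs are automatically disjoint.
-- Edge i j k x y z  means  {x, y, z} ∈ E(A^{ijk}) with
-- x ∈ P^{ij}, y ∈ P^{ik}, z ∈ P^{jk}.  Since A^{ijk} is a set of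
-- unordered triples, Edge is invariant under relabelling (i,j,k).

record ReducedHypergraph : Set₁ where
  field
    n        : ℕ
    size     : Fin n → Fin n → ℕ
    size-sym : ∀ i j → size i j ≡ size j i
    size-pos : ∀ i j → i ≢ j → 0 < size i j
    Edge     : Fin n → Fin n → Fin n → ℕ → ℕ → ℕ → Set
    edge-distinct : ∀ {i j k x y z} → Edge i j k x y z →
                    (i ≢ j) × (i ≢ k) × (j ≢ k)
    edge-valid : ∀ {i j k x y z} → Edge i j k x y z →
                 (x < size i j) × (y < size i k) × (z < size j k)
    edge-swap₁₂ : ∀ {i j k x y z} → Edge i j k x y z → Edge j i k x z y
    edge-swap₂₃ : ∀ {i j k x y z} → Edge i j k x y z → Edge i k j y x z

open ReducedHypergraph public

ContainsClique : ReducedHypergraph → ℕ → Set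
ContainsClique H t =
  Σ (Fin t → Fin (n H)) λ f → Injective _≡_ _≡_ f ×
  Σ (Fin t → Fin t → ℕ) λ V →
    (∀ x y → V x y ≡ V y x) ×
    (∀ x y → x ≢ y → V x y < size H (f x) (f y)) ×
    (∀ x y z → x ≢ y → x ≢ z → y ≢ z →
       Edge H (f x) (f y) (f z) (V x y) (V x z) (V y z))

_∧_ : List ℕ → List ℕ → List ℕ
[] ∧ _ = []
(_ ∷ _) ∧ [] = []
(x ∷ a) ∧ (y ∷ b) with x ≟ y
... | yes _ = x ∷ (a ∧ b)
... | no  _ = []

-- entry a ℓ = a(ℓ) (1-indexed); nothing if out of range
entry : List ℕ → ℕ → Maybe ℕ
entry [] _ = nothing
entry (x ∷ a) zero = nothing
entry (x ∷ a) (suc zero) = just x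
entry (x ∷ a) (suc (suc ℓ)) = entry a (suc ℓ)

record Tree (M k : ℕ) : Set₁ where
  field
    mem    : List ℕ → Set
    root   : mem []
    height : ∀ a → mem a → length a ≤ k
    prefix : ∀ a σ → mem (a ∷ʳ σ) → mem a
    branch : ∀ a → mem a → length a < k →
             Σ (Fin M → ℕ) λ f → Injective _≡_ _≡_ f ×
               (∀ σ → mem (a ∷ʳ σ) ⇔ ∃ λ i → f i ≡ σ)

open Tree public

Leaf : ∀ {M k} → Tree M k → List ℕ → Set
Leaf {k = k} T a = mem T a × length a ≡ k

-- Q(c): d ∈ Q(c) iff |d| = |c| and d_i ∈ S_T(c|(i-1)) ∖ {c_i} for all i.
-- QAux T p c d : p is the already-processed prefix of the original c.
QAux : ∀ {M k} → Tree M k → List ℕ → List ℕ → List ℕ → Set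
QAux T p [] [] = ⊤
QAux T p [] (_ ∷ _) = ⊥
QAux T p (_ ∷ _) [] = ⊥
QAux T p (c ∷ cs) (d ∷ ds) = mem T (p ∷ʳ d) × d ≢ c × QAux T (p ∷ʳ c) cs ds

InQ : ∀ {M k} → Tree M k → List ℕ → List ℕ → Set
InQ T c d = QAux T [] c d

SupportsFortress : ∀ {M k} (H : ReducedHypergraph) (T : Tree M k) →
                   (List ℕ → Fin (n H)) → Set
SupportsFortress H T ι =
  Σ (List ℕ → List ℕ → List ℕ → ℕ) λ P →
    (∀ a b d → Leaf T a → Leaf T b → a ≢ b → InQ T (a ∧ b) d →
       P a b d ≡ P b a d) ×
    (∀ a b d → Leaf T a → Leaf T b → a ≢ b → InQ T (a ∧ b) d →
       P a b d < size H (ι a) (ι b)) ×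
    (∀ a b c d → Leaf T a → Leaf T b → Leaf T c →
       a ≢ b → a ≢ c → b ≢ c →
       length (a ∧ b) ≡ length (a ∧ c) →
       length (a ∧ c) < length (b ∧ c) →
       InQ T (b ∧ c) d →
       entry d (suc (length (a ∧ b))) ≡ entry a (suc (length (a ∧ b))) →
       Edge H (ι a) (ι b) (ι c)
         (P a b (take (length (a ∧ b)) d))
         (P a c (take (length (a ∧ b)) d))
         (P b c d))

ContainsFortress : ReducedHypergraph → ℕ → ℕ → Set₁
ContainsFortress H k M =
  Σ (Tree M k) λ T →
  Σ (List ℕ → Fin (n H)) λ ι →
    (∀ a b → Leaf T a → Leaf T b → ι a ≡ ι b → a ≡ b) ×
    SupportsFortress H T ι

module Submission where

-- Clique ⇒ fortress.  Index the clique by the leaves of the full binary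
-- tree of 0/1-words of length r (an injection into Fin (2^r)) and let
-- P^{ab}_d be the clique vertex of the pair {a,b}, ignoring d.
--
-- Fortress ⇒ clique.  In a binary tree every node c has exactly one
-- "mirror" in Q(c): at each level the other child.  For leaves a ≠ b put
-- W(a,b) = P^{ab}_d with d the mirror of a ∧ b.  The meet lengths of three
-- leaves form an isosceles triangle (they satisfy the ultrametric
-- inequality), and in a binary tree the three meets cannot all have the same
-- length, so after relabelling |a∧b| = |a∧c| < |b∧c|.  Taking d the mirror of
-- b∧c in the fortress condition, its restriction to length |a∧b| is the
-- mirror of a∧b and of a∧c, and d turns at position |a∧b|+1 towards a (the
-- unique sibling of b there), so the fortress edge is exactly the clique edge
-- {W(a,b), W(a,c), W(b,c)}.  Enumerating the 2^r leaves gives the clique.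

open import Defs
open import Data.Nat using (ℕ; _≤_; _^_)
open import Function.Bundles using (_⇔_)

open import Data.Nat using (zero; suc; _+_; _⊓_; _<_; _≟_; z≤n; s≤s)
open import Data.Nat.Properties
  using (≤-refl; ≤-trans; ≤-reflexive; ≤-antisym; <⇒≤; ≤-<-trans; ≮⇒≥; n≮n;
         m≤n⇒m<n∨m≡n; m≤n⇒m⊓n≡m; m<m+n; <-cmp; +-comm; +-assoc; +-identityʳ; suc-injective)
open import Data.List using (List; []; _∷_; _∷ʳ_; _++_; length; take; drop)
open import Data.List.Properties
  using (length-++; ∷ʳ-injectiveʳ; ∷ʳ-++; ++-identityʳ; ++-cancelˡ;
         take++drop≡id; take-take; ∷-injectiveˡ; ∷-injectiveʳ; length-++-≤ˡ)
open import Data.List.Relation.Unary.All using (All; []; _∷_)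
open import Data.List.Relation.Unary.All.Properties using (++⁻ˡ; ∷ʳ⁺; ∷ʳ⁻)
open import Data.Vec using (Vec; []; _∷_)
import Data.Vec.Properties as Vecₚ
open import Data.Maybe using (just)
open import Data.Product using (Σ; ∃; _×_; _,_; proj₁; proj₂; uncurry)
open import Data.Sum using (_⊎_; inj₁; inj₂)
open import Data.Unit using (tt)
open import Data.Empty using (⊥-elim)
open import Relation.Nullary using (¬_; yes; no)
open import Relation.Binary.PropositionalEquality
open import Relation.Binary.Definitions using (tri<; tri≈; tri>)
open import Data.Fin using (Fin; zero; suc; combine; remQuot; toℕ; fromℕ<)
  renaming (_≟_ to _≟ᶠ_)
open import Data.Fin.Properties
  using (toℕ-injective; toℕ-fromℕ<; toℕ<n; combine-injective; combine-remQuot)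
open import Function.Bundles using (Equivalence; mk⇔)
open import Function.Definitions using (Injective)

other-unique : (i j l : Fin 2) → j ≢ i → l ≢ i → l ≡ j
other-unique zero       zero       _          j≢i _   = ⊥-elim (j≢i refl)
other-unique zero       (suc zero) zero       _   l≢i = ⊥-elim (l≢i refl)
other-unique zero       (suc zero) (suc zero) _   _   = refl
other-unique (suc zero) zero       zero       _   _   = refl
other-unique (suc zero) zero       (suc zero) _   l≢i = ⊥-elim (l≢i refl)
other-unique (suc zero) (suc zero) _          j≢i _   = ⊥-elim (j≢i refl)

other : Fin 2 → Fin 2
other zero       = suc zero
other (suc zero) = zero

other≢ : ∀ i → other i ≢ i
other≢ zero       ()
other≢ (suc zero) ()

bits : (h : ℕ) → Fin (2 ^ h) → Vec (Fin 2) h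
bits zero    _ = []
bits (suc h) i = proj₁ (remQuot {2} (2 ^ h) i) ∷ bits h (proj₂ (remQuot {2} (2 ^ h) i))

bits-injective : ∀ h {i j} → bits h i ≡ bits h j → i ≡ j
bits-injective zero    {zero} {zero} _ = refl
bits-injective (suc h) {i}    {j}    e = begin
  i                                  ≡⟨ combine-remQuot {2} (2 ^ h) i ⟨
  uncurry combine (remQuot (2 ^ h) i) ≡⟨ cong (uncurry combine) same-digits ⟩
  uncurry combine (remQuot (2 ^ h) j) ≡⟨ combine-remQuot {2} (2 ^ h) j ⟩
  j                                  ∎
  where
    open ≡-Reasoning
    same-digits : remQuot {2} (2 ^ h) i ≡ remQuot {2} (2 ^ h) j
    same-digits = cong₂ _,_ (Vecₚ.∷-injectiveˡ e) (bits-injective h (Vecₚ.∷-injectiveʳ e))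

∧-comm : ∀ a b → a ∧ b ≡ b ∧ a
∧-comm []      []      = refl
∧-comm []      (_ ∷ _) = refl
∧-comm (_ ∷ _) []      = refl
∧-comm (x ∷ a) (y ∷ b) with x ≟ y | y ≟ x
... | yes refl | yes _    = cong (x ∷_) (∧-comm a b)
... | yes refl | no y≢x   = ⊥-elim (y≢x refl)
... | no x≢y   | yes refl = ⊥-elim (x≢y refl)
... | no _     | no _     = refl

length-∧-comm : ∀ a b → length (a ∧ b) ≡ length (b ∧ a)
length-∧-comm a b = cong length (∧-comm a b)

length-∧-≤ : ∀ a b → length (a ∧ b) ≤ length a
length-∧-≤ []      b       = z≤n
length-∧-≤ (x ∷ a) []      = z≤n
length-∧-≤ (x ∷ a) (y ∷ b) with x ≟ y
... | yes _ = s≤s (length-∧-≤ a b)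
... | no _  = z≤n

∧-take : ∀ a b → take (length (a ∧ b)) a ≡ a ∧ b
∧-take []      b       = refl
∧-take (x ∷ a) []      = refl
∧-take (x ∷ a) (y ∷ b) with x ≟ y
... | yes _ = cong (x ∷_) (∧-take a b)
... | no _  = refl

take-∧ : ∀ j a b → j ≤ length (a ∧ b) → take j a ≡ take j b
take-∧ zero    a       b       _ = refl
take-∧ (suc j) (x ∷ a) (y ∷ b) h with x ≟ y
take-∧ (suc j) (x ∷ a) (.x ∷ b) (s≤s h) | yes refl = cong (x ∷_) (take-∧ j a b h)

∧-≥ : ∀ j a b → j ≤ length a → j ≤ length b → take j a ≡ take j b →
      j ≤ length (a ∧ b)
∧-≥ zero    a       b       _       _       _ = z≤n
∧-≥ (suc j) (x ∷ a) (y ∷ b) (s≤s p) (s≤s q) e with x ≟ y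
... | yes refl = s≤s (∧-≥ j a b p q (∷-injectiveʳ e))
... | no x≢y   = ⊥-elim (x≢y (∷-injectiveˡ e))

ultra : ∀ j a b c → j ≤ length (a ∧ b) → j ≤ length (b ∧ c) → j ≤ length (a ∧ c)
ultra j a b c j≤ab j≤bc =
  ∧-≥ j a c (≤-trans j≤ab (length-∧-≤ a b))
            (≤-trans j≤bc (subst (_≤ length c) (length-∧-comm c b) (length-∧-≤ c b)))
            (trans (take-∧ j a b j≤ab) (take-∧ j b c j≤bc))

take-of-meet : ∀ j a b → j ≤ length (a ∧ b) → take j (a ∧ b) ≡ take j a
take-of-meet j a b j≤ab = begin
  take j (a ∧ b)                       ≡⟨ cong (take j) (∧-take a b) ⟨
  take j (take (length (a ∧ b)) a)     ≡⟨ take-take j (length (a ∧ b)) a ⟩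
  take (j ⊓ length (a ∧ b)) a          ≡⟨ cong (λ m → take m a) (m≤n⇒m⊓n≡m j≤ab) ⟩
  take j a                             ∎
  where open ≡-Reasoning

Step : List ℕ → ℕ → ℕ → Set
Step a j x = take (suc j) a ≡ take j a ∷ʳ x

step-exists : ∀ a j → j < length a → ∃ (Step a j)
step-exists (x ∷ a) zero    _        = x , refl
step-exists (x ∷ a) (suc j) (s≤s j<) with step-exists a j j<
... | y , step = y , cong (x ∷_) step

step-unique : ∀ a j {x y} → Step a j x → Step a j y → x ≡ y
step-unique a j sx sy = ∷ʳ-injectiveʳ (take j a) (take j a) (trans (sym sx) sy)

step-entry : ∀ a j {x} → Step a j x → entry a (suc j) ≡ just x
step-entry (y ∷ a) zero    step = cong just (∷-injectiveˡ step)
step-entry (y ∷ a) (suc j) step = step-entry a j (∷-injectiveʳ step)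

step-of-meet : ∀ a b j {x} → suc j ≤ length (a ∧ b) → Step a j x → Step (a ∧ b) j x
step-of-meet a b j {x} sj≤ab step = begin
  take (suc j) (a ∧ b)  ≡⟨ take-of-meet (suc j) a b sj≤ab ⟩
  take (suc j) a        ≡⟨ step ⟩
  take j a ∷ʳ x         ≡⟨ cong (_∷ʳ x) (take-of-meet j a b (<⇒≤ sj≤ab)) ⟨
  take j (a ∧ b) ∷ʳ x   ∎
  where open ≡-Reasoning

record Divergence (a b : List ℕ) (s : ℕ) : Set where
  constructor divergence
  field
    left       : ℕ
    right      : ℕ
    left-step  : Step a s left
    right-step : Step b s right
    distinct   : left ≢ right

diverge : ∀ a b → length a ≡ length b → a ≢ b → Divergence a b (length (a ∧ b))
diverge []      []      _ a≢b = ⊥-elim (a≢b refl)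
diverge (x ∷ a) (y ∷ b) e a≢b with x ≟ y
... | no x≢y   = divergence x y refl refl x≢y
... | yes refl =
  divergence left right (cong (x ∷_) left-step) (cong (x ∷_) right-step) distinct
  where open Divergence (diverge a b (suc-injective e) (λ a≡b → a≢b (cong (x ∷_) a≡b)))

isosceles-ℕ : ∀ s₁ s₂ s₃ →
  (∀ j → j ≤ s₁ → j ≤ s₂ → j ≤ s₃) →
  (∀ j → j ≤ s₁ → j ≤ s₃ → j ≤ s₂) →
  (∀ j → j ≤ s₂ → j ≤ s₃ → j ≤ s₁) →
  (s₁ ≡ s₂ × s₂ ≡ s₃) ⊎ (s₁ ≡ s₂ × s₂ < s₃) ⊎ (s₁ ≡ s₃ × s₃ < s₂) ⊎ (s₂ ≡ s₃ × s₃ < s₁)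
isosceles-ℕ s₁ s₂ s₃ u₃ u₂ u₁ with <-cmp s₁ s₂
... | tri< s₁<s₂ _ _ = inj₂ (inj₂ (inj₁ (≤-antisym s₁≤s₃ s₃≤s₁ , ≤-<-trans s₃≤s₁ s₁<s₂)))
  where
    s₁≤s₃ = u₃ s₁ ≤-refl (<⇒≤ s₁<s₂)
    s₃≤s₁ = ≮⇒≥ (λ s₁<s₃ → n≮n s₁ (u₁ (suc s₁) s₁<s₂ s₁<s₃))
... | tri> _ _ s₂<s₁ = inj₂ (inj₂ (inj₂ (≤-antisym s₂≤s₃ s₃≤s₂ , ≤-<-trans s₃≤s₂ s₂<s₁)))
  where
    s₂≤s₃ = u₃ s₂ (<⇒≤ s₂<s₁) ≤-refl
    s₃≤s₂ = ≮⇒≥ (λ s₂<s₃ → n≮n s₂ (u₂ (suc s₂) s₂<s₁ s₂<s₃))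
... | tri≈ _ s₁≡s₂ _ with m≤n⇒m<n∨m≡n (u₃ s₂ (≤-reflexive (sym s₁≡s₂)) ≤-refl)
...   | inj₁ s₂<s₃ = inj₂ (inj₁ (s₁≡s₂ , s₂<s₃))
...   | inj₂ s₂≡s₃ = inj₁ (s₁≡s₂ , s₂≡s₃)

-- a is the apex of the triangle a b c: it branches off first.
Apex : List ℕ → List ℕ → List ℕ → Set
Apex a b c = length (a ∧ b) ≡ length (a ∧ c) × length (a ∧ c) < length (b ∧ c)

Equilateral : List ℕ → List ℕ → List ℕ → Set
Equilateral a b c = length (a ∧ b) ≡ length (a ∧ c) × length (a ∧ c) ≡ length (b ∧ c)

isosceles : ∀ a b c → Equilateral a b c ⊎ Apex a b c ⊎ Apex b a c ⊎ Apex c a b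
isosceles a b c with isosceles-ℕ (length (a ∧ b)) (length (a ∧ c)) (length (b ∧ c))
                       (λ j ab ac → ultra j b a c (subst (j ≤_) (length-∧-comm a b) ab) ac)
                       (λ j ab bc → ultra j a b c ab bc)
                       (λ j ac bc → ultra j a c b ac (subst (j ≤_) (length-∧-comm b c) bc))
... | inj₁ equal = inj₁ equal
... | inj₂ (inj₁ apex) = inj₂ (inj₁ apex)
... | inj₂ (inj₂ (inj₁ (e , l))) = inj₂ (inj₂ (inj₁ (trans (length-∧-comm b a) e , l)))
... | inj₂ (inj₂ (inj₂ (e , l))) =
  inj₂ (inj₂ (inj₂ ( trans (length-∧-comm c a) (trans e (length-∧-comm b c))
                   , subst (_< length (a ∧ b)) (length-∧-comm b c) l)))

module BinaryTree {k : ℕ} (T : Tree 2 k) where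

  mem-++ : ∀ xs ys → mem T (xs ++ ys) → mem T xs
  mem-++ xs []       m = subst (mem T) (++-identityʳ xs) m
  mem-++ xs (y ∷ ys) m = prefix T xs y (mem-++ (xs ∷ʳ y) ys (subst (mem T) (sym (∷ʳ-++ xs y ys)) m))

  mem-take : ∀ j a → mem T a → mem T (take j a)
  mem-take j a m = mem-++ (take j a) (drop j a) (subst (mem T) (sym (take++drop≡id j a)) m)

  step-mem : ∀ {a j x p} → mem T a → take j a ≡ p → Step a j x → mem T (p ∷ʳ x)
  step-mem {a} {j} {x} m refl step = subst (mem T) step (mem-take (suc j) a m)

  parent-depth : ∀ p x → mem T (p ∷ʳ x) → length p < k
  parent-depth p x m =
    subst (_≤ k) (trans (length-++ p) (+-comm (length p) 1)) (height T _ m)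

  sibling-unique : ∀ {p x y z} → mem T (p ∷ʳ x) → mem T (p ∷ʳ y) → mem T (p ∷ʳ z) →
                   y ≢ x → z ≢ x → z ≡ y
  sibling-unique {p} {x} mx my mz y≢x z≢x
    with branch T p (prefix T p x mx) (parent-depth p x mx)
  ... | f , _ , children
    with Equivalence.to (children _) mx | Equivalence.to (children _) my
       | Equivalence.to (children _) mz
  ... | i , refl | j , refl | l , refl =
    cong f (other-unique i j l (λ j≡i → y≢x (cong f j≡i)) (λ l≡i → z≢x (cong f l≡i)))

  sibling-exists : ∀ p x → mem T (p ∷ʳ x) → Σ ℕ λ z → mem T (p ∷ʳ z) × z ≢ x
  sibling-exists p x mx with branch T p (prefix T p x mx) (parent-depth p x mx)
  ... | f , f-inj , children with Equivalence.to (children x) mx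
  ... | i , refl = f (other i) , Equivalence.from (children _) (other i , refl)
                 , λ e → other≢ i (f-inj e)

  -- Mirrors: Q(c) has exactly one element, obtained by taking the sibling
  -- step at every level.  QAux T p c d allows an already processed prefix p.
  Q-exists : ∀ p c → mem T (p ++ c) → Σ (List ℕ) (QAux T p c)
  Q-exists p []       _ = [] , tt
  Q-exists p (x ∷ cs) m with sibling-exists p x (mem-++ (p ∷ʳ x) cs m′)
                           | Q-exists (p ∷ʳ x) cs m′
    where m′ = subst (mem T) (sym (∷ʳ-++ p x cs)) m
  ... | z , mz , z≢x | ds , q = z ∷ ds , mz , z≢x , q

  Q-unique : ∀ p c {d d′} → mem T (p ++ c) → QAux T p c d → QAux T p c d′ → d ≡ d′
  Q-unique p []       {[]}    {[]}      _ _ _ = refl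
  Q-unique p (x ∷ cs) {y ∷ d} {y′ ∷ d′} m (my , y≢x , q) (my′ , y′≢x , q′) =
    cong₂ _∷_ (sym (sibling-unique mx my my′ y≢x y′≢x)) (Q-unique (p ∷ʳ x) cs m′ q q′)
    where
      m′ = subst (mem T) (sym (∷ʳ-++ p x cs)) m
      mx = mem-++ (p ∷ʳ x) cs m′

  Q-take : ∀ p c d j → QAux T p c d → QAux T p (take j c) (take j d)
  Q-take p c        d        zero    _           = tt
  Q-take p []       []       (suc j) _           = tt
  Q-take p (x ∷ cs) (y ∷ ds) (suc j) (my , y≢x , q) = my , y≢x , Q-take (p ∷ʳ x) cs ds j q

  Q-length : ∀ p c d → QAux T p c d → length d ≡ length c
  Q-length p []       []       _           = refl
  Q-length p (x ∷ cs) (y ∷ ds) (_ , _ , q) = cong suc (Q-length (p ∷ʳ x) cs ds q)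

  Q-step : ∀ p c d j {x y} → QAux T p c d → Step c j x → Step d j y →
           y ≢ x × mem T ((p ++ take j c) ∷ʳ y)
  Q-step p (x ∷ cs) (y ∷ ds) zero    (my , y≢x , _) refl refl =
    y≢x , subst (λ p′ → mem T (p′ ∷ʳ y)) (sym (++-identityʳ p)) my
  Q-step p (x ∷ cs) (y ∷ ds) (suc j) (_ , _ , q) cstep dstep
    with Q-step (p ∷ʳ x) cs ds j q (∷-injectiveʳ cstep) (∷-injectiveʳ dstep)
  ... | y≢x , m = y≢x , subst (λ p′ → mem T (p′ ∷ʳ _)) (∷ʳ-++ p x (take j cs)) m

  Q-restrict : ∀ c c′ j {d d′} → mem T c′ → take j c ≡ c′ →
               InQ T c d → InQ T c′ d′ → take j d ≡ d′
  Q-restrict c c′ j m refl q q′ = Q-unique [] (take j c) m (Q-take [] c _ j q) q′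

  not-equilateral : ∀ {a b c} → mem T a → mem T b → mem T c →
                    length a ≡ length b → length a ≡ length c →
                    a ≢ b → a ≢ c → b ≢ c → ¬ Equilateral a b c
  not-equilateral {a} {b} {c} ma mb mc lab lac a≢b a≢c b≢c (e₁ , e₂) =
    distinct Dbc (trans (step-unique b s (left-step Dbc) (right-step Dab))
                        (sym (trans (step-unique c s (right-step Dbc) (right-step Dac)) xc≡xb)))
    where
      open Divergence
      s = length (a ∧ b)
      Dab = diverge a b lab a≢b
      Dac = subst (Divergence a c) (sym e₁) (diverge a c lac a≢c)
      Dbc = subst (Divergence b c) (sym (trans e₁ e₂)) (diverge b c (trans (sym lab) lac) b≢c)
      -- left Dab, right Dab and right Dac are children of the node take s a.
      node-b : take s b ≡ take s a
      node-b = sym (take-∧ s a b ≤-refl)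
      node-c : take s c ≡ take s a
      node-c = sym (take-∧ s a c (≤-reflexive e₁))
      xc≡xb : right Dac ≡ right Dab
      xc≡xb = sibling-unique (step-mem ma refl (left-step Dab))
                (step-mem mb node-b (right-step Dab)) (step-mem mc node-c (right-step Dac))
                (≢-sym (distinct Dab))
                (λ e → distinct Dac (trans (step-unique a s (left-step Dac) (left-step Dab)) (sym e)))

  -- Enumeration of the leaves.  Below a node p the word β picks children
  -- level by level; the invariant |p| + h ≡ k says h levels remain.
  -- The β-th child of a node p of depth < k.
  child : ∀ p → mem T p → length p < k → Fin 2 → ℕ
  child p m p<k = proj₁ (branch T p m p<k)

  child-mem : ∀ p m p<k β → mem T (p ∷ʳ child p m p<k β)
  child-mem p m p<k β = Equivalence.from (proj₂ (proj₂ (branch T p m p<k)) _) (β , refl)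

  child-injective : ∀ p m p<k → Injective _≡_ _≡_ (child p m p<k)
  child-injective p m p<k = proj₁ (proj₂ (branch T p m p<k))

  not-bottom : ∀ (p : List ℕ) h → length p + suc h ≡ k → length p < k
  not-bottom p h e = subst (length p <_) e (m<m+n (length p) (s≤s z≤n))

  next : ∀ p → mem T p → ∀ h → length p + suc h ≡ k → Fin 2 → List ℕ
  next p m h e β = p ∷ʳ child p m (not-bottom p h e) β

  next-mem : ∀ p m h e β → mem T (next p m h e β)
  next-mem p m h e β = child-mem p m (not-bottom p h e) β

  next-depth : ∀ p m h e β → length (next p m h e β) + h ≡ k
  next-depth p m h e β = trans (cong (_+ h) (length-++ p)) (trans (+-assoc (length p) 1 h) e)

  descend : ∀ p → mem T p → ∀ h → length p + h ≡ k → Vec (Fin 2) h → List ℕ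
  descend p m zero    e []       = p
  descend p m (suc h) e (β ∷ βs) =
    descend (next p m h e β) (next-mem p m h e β) h (next-depth p m h e β) βs

  descend-leaf : ∀ p m h e βs → Leaf T (descend p m h e βs)
  descend-leaf p m zero    e []       = m , trans (sym (+-identityʳ (length p))) e
  descend-leaf p m (suc h) e (β ∷ βs) = descend-leaf _ _ h _ βs

  first-step : ∀ p m h e β βs → Σ (List ℕ) λ q →
               descend p m (suc h) e (β ∷ βs) ≡ p ++ (child p m (not-bottom p h e) β ∷ q)

  descend-extends : ∀ p m h e βs → Σ (List ℕ) λ q → descend p m h e βs ≡ p ++ q
  descend-extends p m zero    e []       = [] , sym (++-identityʳ p)
  descend-extends p m (suc h) e (β ∷ βs) with first-step p m h e β βs
  ... | q , eq = _ ∷ q , eq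

  first-step p m h e β βs
    with descend-extends (next p m h e β) (next-mem p m h e β) h (next-depth p m h e β) βs
  ... | q , eq = q , trans eq (∷ʳ-++ p _ q)

  descend-injective : ∀ p m h e βs γs → descend p m h e βs ≡ descend p m h e γs → βs ≡ γs
  descend-injective p m zero    e []       []       _  = refl
  descend-injective p m (suc h) e (β ∷ βs) (γ ∷ γs) eq with β ≟ᶠ γ
  ... | yes refl = cong (β ∷_) (descend-injective (next p m h e β) (next-mem p m h e β) h
                                   (next-depth p m h e β) βs γs eq)
  ... | no β≢γ with first-step p m h e β βs | first-step p m h e γ γs
  ...   | q , eqβ | q′ , eqγ =
    ⊥-elim (β≢γ (child-injective p m (not-bottom p h e)
                  (∷-injectiveˡ (++-cancelˡ p _ _ (trans (sym eqβ) (trans eq eqγ))))))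

  leaf : Fin (2 ^ k) → List ℕ
  leaf i = descend [] (root T) k refl (bits k i)

  leaf-is-leaf : ∀ i → Leaf T (leaf i)
  leaf-is-leaf i = descend-leaf [] (root T) k refl (bits k i)

  leaf-injective : ∀ {i j} → leaf i ≡ leaf j → i ≡ j
  leaf-injective {i} {j} e = bits-injective k (descend-injective [] (root T) k refl (bits k i) (bits k j) e)

module FortressToClique
  (H : ReducedHypergraph) (r : ℕ) (T : Tree 2 r) (ι : List ℕ → Fin (n H))
  (ι-injective : ∀ a b → Leaf T a → Leaf T b → ι a ≡ ι b → a ≡ b)
  (P : List ℕ → List ℕ → List ℕ → ℕ)
  (P-sym : ∀ a b d → Leaf T a → Leaf T b → a ≢ b → InQ T (a ∧ b) d → P a b d ≡ P b a d)
  (P-size : ∀ a b d → Leaf T a → Leaf T b → a ≢ b → InQ T (a ∧ b) d →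
            P a b d < size H (ι a) (ι b))
  (P-edge : ∀ a b c d → Leaf T a → Leaf T b → Leaf T c →
            a ≢ b → a ≢ c → b ≢ c →
            length (a ∧ b) ≡ length (a ∧ c) →
            length (a ∧ c) < length (b ∧ c) →
            InQ T (b ∧ c) d →
            entry d (suc (length (a ∧ b))) ≡ entry a (suc (length (a ∧ b))) →
            Edge H (ι a) (ι b) (ι c)
              (P a b (take (length (a ∧ b)) d))
              (P a c (take (length (a ∧ b)) d))
              (P b c d)) where

  open BinaryTree T

  L : Fin (2 ^ r) → List ℕ
  L = leaf

  L-mem : ∀ x → mem T (L x)
  L-mem x = proj₁ (leaf-is-leaf x)

  L-distinct : ∀ {x y} → x ≢ y → L x ≢ L y
  L-distinct x≢y e = x≢y (leaf-injective e)

  same-depth : ∀ x y → length (L x) ≡ length (L y)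
  same-depth x y = trans (proj₂ (leaf-is-leaf x)) (sym (proj₂ (leaf-is-leaf y)))

  meet-mem : ∀ x y → mem T (L x ∧ L y)
  meet-mem x y = subst (mem T) (∧-take (L x) (L y)) (mem-take _ (L x) (L-mem x))

  mirror : Fin (2 ^ r) → Fin (2 ^ r) → List ℕ
  mirror x y = proj₁ (Q-exists [] (L x ∧ L y) (meet-mem x y))

  mirror-Q : ∀ x y → InQ T (L x ∧ L y) (mirror x y)
  mirror-Q x y = proj₂ (Q-exists [] (L x ∧ L y) (meet-mem x y))

  W : Fin (2 ^ r) → Fin (2 ^ r) → ℕ
  W x y = P (L x) (L y) (mirror x y)

  -- W is symmetric: mirrors depend only on the (symmetric) meet.
  W-sym : ∀ x y → W x y ≡ W y x
  W-sym x y with x ≟ᶠ y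
  ... | yes refl = refl
  ... | no x≢y   = trans (P-sym (L x) (L y) (mirror x y) (leaf-is-leaf x) (leaf-is-leaf y)
                                (L-distinct x≢y) (mirror-Q x y))
                         (cong (P (L y) (L x)) mirror-sym)
    where
      mirror-sym : mirror x y ≡ mirror y x
      mirror-sym = Q-unique [] (L y ∧ L x) (meet-mem y x)
                     (subst (λ c → InQ T c (mirror x y)) (∧-comm (L x) (L y)) (mirror-Q x y))
                     (mirror-Q y x)

  W-size : ∀ x y → x ≢ y → W x y < size H (ι (L x)) (ι (L y))
  W-size x y x≢y = P-size (L x) (L y) (mirror x y) (leaf-is-leaf x) (leaf-is-leaf y)
                          (L-distinct x≢y) (mirror-Q x y)

  -- The clique edge on a triangle with apex x is the fortress edge for the
  -- mirror d of L y ∧ L z: d restricts to the mirrors of L x ∧ L y and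
  -- L x ∧ L z, and right after the apex's meet d turns towards L x.
  apex-edge : ∀ x y z → x ≢ y → x ≢ z → y ≢ z → Apex (L x) (L y) (L z) →
              Edge H (ι (L x)) (ι (L y)) (ι (L z)) (W x y) (W x z) (W y z)
  apex-edge x y z x≢y x≢z y≢z (e , s<t) =
    subst₂ (λ u v → Edge H (ι a) (ι b) (ι c) (P a b u) (P a c v) (W y z))
      (Q-restrict (b ∧ c) (a ∧ b) s (meet-mem x y) below-ab d-Q (mirror-Q x y))
      (Q-restrict (b ∧ c) (a ∧ c) s (meet-mem x z) below-ac d-Q (mirror-Q x z))
      (P-edge a b c d (leaf-is-leaf x) (leaf-is-leaf y) (leaf-is-leaf z)
         (L-distinct x≢y) (L-distinct x≢z) (L-distinct y≢z) e s<t d-Q turns-to-a)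
    where
      open ≡-Reasoning
      a = L x
      b = L y
      c = L z
      d = mirror y z
      d-Q = mirror-Q y z
      s = length (a ∧ b)
      s<bc : s < length (b ∧ c)
      s<bc = subst (_< length (b ∧ c)) (sym e) s<t
      node : take s (b ∧ c) ≡ take s a
      node = trans (take-of-meet s b c (<⇒≤ s<bc)) (sym (take-∧ s a b ≤-refl))
      below-ab : take s (b ∧ c) ≡ a ∧ b
      below-ab = trans node (∧-take a b)
      below-ac : take s (b ∧ c) ≡ a ∧ c
      below-ac = trans node (subst (λ m → take m a ≡ a ∧ c) (sym e) (∧-take a c))
      open Divergence (diverge a b (same-depth x y) (L-distinct x≢y))
      d-turn : ∃ (Step d s)
      d-turn = step-exists d s (subst (s <_) (sym (Q-length [] (b ∧ c) d d-Q)) s<bc)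
      mirror-turn : proj₁ d-turn ≢ right × mem T (take s (b ∧ c) ∷ʳ proj₁ d-turn)
      mirror-turn = Q-step [] (b ∧ c) d s d-Q (step-of-meet b c s s<bc right-step) (proj₂ d-turn)
      turn≡left : proj₁ d-turn ≡ left
      turn≡left = sibling-unique (step-mem (L-mem y) (sym (take-∧ s a b ≤-refl)) right-step)
                    (step-mem (L-mem x) refl left-step)
                    (subst (λ p → mem T (p ∷ʳ proj₁ d-turn)) node (proj₂ mirror-turn))
                    distinct (proj₁ mirror-turn)
      turns-to-a : entry d (suc s) ≡ entry a (suc s)
      turns-to-a = begin
        entry d (suc s)       ≡⟨ step-entry d s (proj₂ d-turn) ⟩
        just (proj₁ d-turn)   ≡⟨ cong just turn≡left ⟩
        just left             ≡⟨ step-entry a s left-step ⟨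
        entry a (suc s)       ∎

  -- Every triangle has an apex (a binary tree has no equilateral triangles),
  -- and edges and W are symmetric, so every triangle carries an edge.
  W-edge : ∀ x y z → x ≢ y → x ≢ z → y ≢ z →
           Edge H (ι (L x)) (ι (L y)) (ι (L z)) (W x y) (W x z) (W y z)
  W-edge x y z x≢y x≢z y≢z with isosceles (L x) (L y) (L z)
  ... | inj₁ equilateral =
    ⊥-elim (not-equilateral (L-mem x) (L-mem y) (L-mem z) (same-depth x y) (same-depth x z)
              (L-distinct x≢y) (L-distinct x≢z) (L-distinct y≢z) equilateral)
  ... | inj₂ (inj₁ apex-x) = apex-edge x y z x≢y x≢z y≢z apex-x
  ... | inj₂ (inj₂ (inj₁ apex-y)) =
    subst (λ u → Edge H (ι (L x)) (ι (L y)) (ι (L z)) u (W x z) (W y z)) (W-sym y x)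
      (edge-swap₁₂ H (apex-edge y x z (≢-sym x≢y) y≢z x≢z apex-y))
  ... | inj₂ (inj₂ (inj₂ apex-z)) =
    subst₂ (λ u v → Edge H (ι (L x)) (ι (L y)) (ι (L z)) (W x y) u v) (W-sym z x) (W-sym z y)
      (edge-swap₂₃ H (edge-swap₁₂ H (apex-edge z x y (≢-sym x≢z) (≢-sym y≢z) x≢y apex-z)))

  clique : ContainsClique H (2 ^ r)
  clique = (λ x → ι (L x))
         , (λ {x} {y} e → leaf-injective (ι-injective (L x) (L y) (leaf-is-leaf x) (leaf-is-leaf y) e))
         , W , W-sym , W-size , W-edge

fortress⇒clique : ∀ H r → ContainsFortress H r 2 → ContainsClique H (2 ^ r)
fortress⇒clique H r (T , ι , ι-injective , P , P-sym , P-size , P-edge) =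
  FortressToClique.clique H r T ι ι-injective P P-sym P-size P-edge

BinaryWord : ℕ → List ℕ → Set
BinaryWord r a = All (_< 2) a × length a ≤ r

fullBinaryTree : ∀ r → Tree 2 r
fullBinaryTree r = record
  { mem    = BinaryWord r
  ; root   = [] , z≤n
  ; height = λ _ → proj₂
  ; prefix = λ a _ (digits , a≤r) → ++⁻ˡ a digits , ≤-trans (length-++-≤ˡ a) a≤r
  ; branch = λ a w a<r → toℕ , toℕ-injective , λ σ → mk⇔ (digit a σ) (extend a w a<r σ)
  }
  where
    digit : ∀ a σ → BinaryWord r (a ∷ʳ σ) → ∃ λ (i : Fin 2) → toℕ i ≡ σ
    digit a σ (digits , _) = fromℕ< (proj₂ (∷ʳ⁻ digits)) , toℕ-fromℕ< (proj₂ (∷ʳ⁻ digits))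
    extend : ∀ a → BinaryWord r a → length a < r → ∀ σ →
             (∃ λ (i : Fin 2) → toℕ i ≡ σ) → BinaryWord r (a ∷ʳ σ)
    extend a (digits , _) a<r .(toℕ i) (i , refl) =
      ∷ʳ⁺ digits (toℕ<n i) , subst (_≤ r) (sym (trans (length-++ a) (+-comm (length a) 1))) a<r

bit : ℕ → Fin 2
bit zero    = zero
bit (suc _) = suc zero

bit-injective : ∀ {x y} → x < 2 → y < 2 → bit x ≡ bit y → x ≡ y
bit-injective {zero}     {zero}     _                 _                 _  = refl
bit-injective {suc zero} {suc zero} _                 _                 _  = refl
bit-injective {suc (suc _)} {_}     (s≤s (s≤s ())) _ _
bit-injective {_}        {suc (suc _)} _            (s≤s (s≤s ())) _
bit-injective {zero}     {suc zero} _ _ ()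
bit-injective {suc zero} {zero}     _ _ ()

encode : (k : ℕ) → List ℕ → Fin (2 ^ k)
encode zero    _        = zero
encode (suc k) []       = combine {2} zero (encode k [])
encode (suc k) (x ∷ xs) = combine {2} (bit x) (encode k xs)

encode-injective : ∀ k {a b} → All (_< 2) a → All (_< 2) b → length a ≡ k → length b ≡ k →
                   encode k a ≡ encode k b → a ≡ b
encode-injective zero    {[]}     {[]}     _          _          _  _  _ = refl
encode-injective (suc k) {x ∷ xs} {y ∷ ys} (x<2 ∷ xs<2) (y<2 ∷ ys<2) la lb e =
  cong₂ _∷_ (bit-injective x<2 y<2 (proj₁ same))
            (encode-injective k xs<2 ys<2 (suc-injective la) (suc-injective lb) (proj₂ same))
  where same = combine-injective (bit x) (encode k xs) (bit y) (encode k ys) e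

clique⇒fortress : ∀ H r → ContainsClique H (2 ^ r) → ContainsFortress H r 2
clique⇒fortress H r (f , f-injective , V , V-sym , V-size , V-edge) =
  fullBinaryTree r , (λ a → f (encode r a)) ,
  (λ a b la lb e → leaf-code-injective la lb (f-injective e)) ,
  (λ a b _ → V (encode r a) (encode r b)) ,
  (λ a b _ _ _ _ _ → V-sym _ _) ,
  (λ a b _ la lb a≢b _ → V-size _ _ (codes-distinct la lb a≢b)) ,
  (λ a b c _ la lb lc a≢b a≢c b≢c _ _ _ _ →
     V-edge _ _ _ (codes-distinct la lb a≢b) (codes-distinct la lc a≢c) (codes-distinct lb lc b≢c))
  where
    leaf-code-injective : ∀ {a b} → Leaf (fullBinaryTree r) a → Leaf (fullBinaryTree r) b →
                          encode r a ≡ encode r b → a ≡ b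
    leaf-code-injective ((a-bits , _) , la) ((b-bits , _) , lb) = encode-injective r a-bits b-bits la lb
    codes-distinct : ∀ {a b} → Leaf (fullBinaryTree r) a → Leaf (fullBinaryTree r) b →
                     a ≢ b → encode r a ≢ encode r b
    codes-distinct la lb a≢b e = a≢b (leaf-code-injective la lb e)

-- Theorem.  For every r a reduced
-- hypergraph contains an [r,2]-fortress iff it contains a clique of order 2^r.
fact4p5 : (r : ℕ) → 2 ≤ r → (H : ReducedHypergraph) →
          ContainsFortress H r 2 ⇔ ContainsClique H (2 ^ r)
fact4p5 r _ H = mk⇔ (fortress⇒clique H r) (clique⇒fortress H r)
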